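{- Let $\mathbb P$ be a poset. Every $\mathrm K$-linked subset $Q\subseteq\mathbb P$ is $\mathrm{Fr}$-linked.
   Context: For $A\subseteq\mathbb P$, $A^{\not\perp}=\{p\in\mathbb P:\exists q\in A\ p\text{ compatible with }q\}$; $B$ refines $A$ if every $p\in B$ is below some $q\in A$. $Q\subseteq\mathbb P$ is $\mathrm K$-linked if there is $Q'\subseteq\mathbb P$ such that (a) there is a finite $A\subseteq Q'$ with $Q\subseteq A^{\not\perp}$, and (b) whenever $A\subseteq Q'$ is finite with $Q\subseteq A^{\not\perp}$, for every open dense $D\subseteq\mathbb P$ there is a finite $B\subseteq D\cap Q'$ refining $A$ with $Q\subseteq B^{\not\perp}$. $Q\subseteq\mathbb P$ is $\mathrm{Fr}$-linked if for every sequence $\langle p_n:n<\omega\rangle$ of elements of $Q$ there is $q\in\mathbb P$ forcing that $\{n\in\omega:p_n\in\dot G\}$ is infinite, where $\dot G$ is the canonical name of the generic filter. -}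

module Defs where

open import Level using (0ℓ)
open import Data.Nat using (ℕ) renaming (_≤_ to _≤ℕ_)
open import Data.Product using (Σ; _×_; ∃; ∃-syntax)
open import Data.List using (List)
open import Data.List.Relation.Unary.All using (All)
open import Data.List.Relation.Unary.Any using (Any)
open import Relation.Binary.Bundles using (Poset)

-- A forcing poset ℙ; q ≤ p means q is stronger (extends) p.
module _ (ℙ : Poset 0ℓ 0ℓ 0ℓ) where
  open Poset ℙ renaming (Carrier to P)

  Subset : Set₁
  Subset = P → Set

  Compatible : P → P → Set
  Compatible p q = ∃[ r ] (r ≤ p × r ≤ q)

  FinSubsetOf : Subset → List P → Set
  FinSubsetOf X A = All X A

  CoveredBy : Subset → List P → Set
  CoveredBy Q A = ∀ p → Q p → Any (Compatible p) A

  Refines : List P → List P → Set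
  Refines B A = All (λ p → Any (λ q → p ≤ q) A) B

  OpenDense : Subset → Set
  OpenDense D = (∀ p q → D p → q ≤ p → D q) × (∀ p → ∃[ q ] (q ≤ p × D q))

  KLinked : Subset → Set₁
  KLinked Q = Σ Subset λ Q' →
      (∃[ A ] (FinSubsetOf Q' A × CoveredBy Q A))
    × (∀ A → FinSubsetOf Q' A → CoveredBy Q A →
         ∀ D → OpenDense D →
           ∃[ B ] (FinSubsetOf (λ r → D r × Q' r) B × Refines B A × CoveredBy Q B))

  -- q ⊩ "{n : p n ∈ Ġ} is infinite", unfolded via the forcing relation:
  -- for every m, the set {s : ∃ n ≥ m, s ≤ p n} is dense below q.
  ForcesInfinitelyOften : P → (ℕ → P) → Set
  ForcesInfinitelyOften q p =
    ∀ r → r ≤ q → ∀ (m : ℕ) → ∃[ n ] (m ≤ℕ n × ∃[ s ] (s ≤ r × s ≤ p n))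

  FrLinked : Subset → Set
  FrLinked Q = ∀ (p : ℕ → P) → (∀ n → Q (p n)) → ∃[ q ] ForcesInfinitelyOften q p

{-# OPTIONS --safe #-}
module Submission where

open import Defs
open import Level using (0ℓ)
open import Function using (_∘_)
open import Relation.Binary.Bundles using (Poset)
open import Axiom.ExcludedMiddle using (ExcludedMiddle)
open import Axiom.DoubleNegationElimination using (DoubleNegationElimination; em⇒dne)
open import Data.Nat using (ℕ; _⊔_) renaming (_≤_ to _≤ℕ_)
open import Data.Nat.Properties using (≤-refl; ≤-trans; m≤m⊔n; m≤n⊔m)
open import Data.Product using (_×_; _,_; ∃-syntax; proj₁)
open import Data.List using (List)
open import Data.List.Relation.Unary.All as All using (All; []; _∷_)
open import Data.List.Relation.Unary.All.Properties using (All¬⇒¬Any)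
open import Relation.Nullary using (¬_)

-- If no condition forces p n ∈ Ġ for infinitely many n, then every condition
-- has an extension that is incompatible with all but finitely many p n, so
-- these extensions form an open dense set D.  K-linkedness provides a finite
-- B ⊆ D with Q ⊆ B^{not ⊥}; past a common bound M for the elements of B,
-- the condition p M ∈ Q is incompatible with all of B, a contradiction.

Eventually : (ℕ → Set) → Set
Eventually P = ∃[ m ] (∀ n → m ≤ℕ n → P n)

eventually-× : {P R : ℕ → Set} →
  Eventually P → Eventually R → Eventually (λ n → P n × R n)
eventually-× (k , Pₙ) (m , Rₙ) =
  k ⊔ m , λ n k⊔m≤n → Pₙ n (≤-trans (m≤m⊔n k m) k⊔m≤n)
                    , Rₙ n (≤-trans (m≤n⊔m k m) k⊔m≤n)

All-eventually : {A : Set} {P : A → ℕ → Set} {xs : List A} →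
  All (Eventually ∘ P) xs → Eventually (λ n → All (λ x → P x n) xs)
All-eventually []            = 0 , λ _ _ → []
All-eventually (ev ∷ evs) with eventually-× ev (All-eventually evs)
... | m , Pₙ = m , λ n m≤n → let px , pxs = Pₙ n m≤n in px ∷ pxs

module _ (ℙ : Poset 0ℓ 0ℓ 0ℓ) where
  open Poset ℙ renaming (Carrier to P)

  compatible-≤ʳ : ∀ {p q r} → r ≤ q → Compatible ℙ p r → Compatible ℙ p q
  compatible-≤ʳ r≤q (s , s≤p , s≤r) = s , s≤p , trans s≤r r≤q

  EventuallyIncompatible : (ℕ → P) → Subset ℙ
  EventuallyIncompatible p r = Eventually (λ n → ¬ Compatible ℙ (p n) r)

  eventuallyIncompatible-open : ∀ p q r →
    EventuallyIncompatible p q → r ≤ q → EventuallyIncompatible p r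
  eventuallyIncompatible-open p q r (m , incompat) r≤q =
    m , λ n m≤n → incompat n m≤n ∘ compatible-≤ʳ r≤q

  ¬forces⇒eventuallyIncompatible-below : DoubleNegationElimination 0ℓ →
    ∀ {q} p → ¬ ForcesInfinitelyOften ℙ q p →
    ∃[ r ] (r ≤ q × EventuallyIncompatible p r)
  ¬forces⇒eventuallyIncompatible-below dne {q} p ¬forces = dne λ ¬below →
    ¬forces λ r r≤q m → dne λ ¬meets →
      ¬below (r , r≤q , m , λ n m≤n (s , s≤pn , s≤r) → ¬meets (n , m≤n , s , s≤r , s≤pn))

  eventuallyIncompatible-openDense : DoubleNegationElimination 0ℓ →
    ∀ p → ¬ (∃[ q ] ForcesInfinitelyOften ℙ q p) →
    OpenDense ℙ (EventuallyIncompatible p)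
  eventuallyIncompatible-openDense dne p ¬forces =
      eventuallyIncompatible-open p
    , λ q → ¬forces⇒eventuallyIncompatible-below dne p (¬forces ∘ (q ,_))

lemma5p15 : ExcludedMiddle 0ℓ → (ℙ : Poset 0ℓ 0ℓ 0ℓ) → (Q : Subset ℙ) →
    KLinked ℙ Q → FrLinked ℙ Q
lemma5p15 em ℙ Q (Q' , (A , A⊆Q' , Q⊆A) , refine) p p∈Q = em⇒dne em λ ¬forces →
  let D = EventuallyIncompatible ℙ p
      B , B⊆D∩Q' , _ , Q⊆B =
        refine A A⊆Q' Q⊆A D (eventuallyIncompatible-openDense ℙ (em⇒dne em) p ¬forces)
      M , incompatible = All-eventually (All.map proj₁ B⊆D∩Q')
  in All¬⇒¬Any (incompatible M ≤-refl) (Q⊆B (p M) (p∈Q M))
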